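{- A semigroup $S\subseteq\mathbb{N}$ is dimension-$2$ realizable if and only if it is a Lucas semigroup, i.e., $S=\mathcal{L}(P,Q,R)$ for some $P,Q\in\mathbb{Z}$ and $R\in\mathbb{Q}$.
   Context: $\mathbb{N}=\{0,1,2,\ldots\}$; a semigroup is an additive submonoid of $\mathbb{N}$. For $P,Q\in\mathbb{Z}$, the Lucas sequence $U_n=U_n(P,Q)$ is defined by $U_0=0$, $U_1=1$, $U_{n+2}=PU_{n+1}-QU_n$. For $R\in\mathbb{Q}$, $\mathcal{L}(P,Q,R)=\{n\in\mathbb{N} : U_nR\in\mathbb{Z}\}$. For $A\in\mathrm{M}_d(\mathbb{Q})$, $\mathcal{S}(A)=\{n\in\mathbb{N}: A^n\in\mathrm{M}_d(\mathbb{Z})\}$. A semigroup $S$ is dimension-$2$ realizable if $S=\mathcal{S}(A)$ for some $A\in\mathrm{M}_2(\mathbb{Q})$. -}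

module Defs where

open import Data.Nat using (ℕ; zero; suc)
open import Data.Integer as ℤ using (ℤ)
open import Data.Rational as ℚ using (ℚ; _/_; 0ℚ; 1ℚ)
open import Data.Fin using (Fin; zero; suc)
open import Data.Product using (∃-syntax; _×_)
open import Relation.Binary.PropositionalEquality using (_≡_)

Subset : Set₁
Subset = ℕ → Set

IsNumericalSemigroup : Subset → Set
IsNumericalSemigroup S = S 0 × (∀ m n → S m → S n → S (m Data.Nat.+ n))

_≐_ : Subset → Subset → Set
S ≐ T = ∀ n → (S n → T n) × (T n → S n)

IsInteger : ℚ → Set
IsInteger q = ∃[ z ] q ≡ z / 1

U : ℤ → ℤ → ℕ → ℤ
U P Q zero = ℤ.0ℤ
U P Q (suc zero) = ℤ.1ℤ
U P Q (suc (suc n)) = P ℤ.* U P Q (suc n) ℤ.- Q ℤ.* U P Q n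

Lucas : ℤ → ℤ → ℚ → Subset
Lucas P Q R n = IsInteger ((U P Q n / 1) ℚ.* R)

Mat2 : Set
Mat2 = Fin 2 → Fin 2 → ℚ

_⊗_ : Mat2 → Mat2 → Mat2
(A ⊗ B) i j = A i zero ℚ.* B zero j ℚ.+ A i (suc zero) ℚ.* B (suc zero) j

I2 : Mat2
I2 zero zero = 1ℚ
I2 zero (suc zero) = 0ℚ
I2 (suc zero) zero = 0ℚ
I2 (suc zero) (suc zero) = 1ℚ

_^_ : Mat2 → ℕ → Mat2
A ^ zero = I2
A ^ suc n = A ⊗ (A ^ n)

IsIntegerMatrix : Mat2 → Set
IsIntegerMatrix A = ∀ i j → IsInteger (A i j)

𝒮 : Mat2 → Subset
𝒮 A n = IsIntegerMatrix (A ^ n)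

Dim2Realizable : Subset → Set
Dim2Realizable S = ∃[ A ] S ≐ 𝒮 A

IsLucasSemigroup : Subset → Set
IsLucasSemigroup S = ∃[ P ] ∃[ Q ] ∃[ R ] S ≐ Lucas P Q R

-- For A ∈ M₂(ℚ) with trace t and determinant d, Cayley–Hamilton makes every entry of Aⁿ obey
-- xₙ₊₂ = t xₙ₊₁ − d xₙ, whence Aⁿ⁺¹ = Uₙ₊₁(t,d) A − d Uₙ(t,d) I.  If t, d ∈ ℤ, this shows that
-- Aⁿ⁺¹ is integral iff Uₙ₊₁ A is, i.e. iff the lcm L of the denominators of the entries of A
-- divides Uₙ₊₁; so 𝒮(A) = 𝓛(t, d, 1/L).  Otherwise no positive power of A is integral: det(A)ⁿ and
-- tr(Aⁿ) would be integers, and for t = p/q in lowest terms qⁿ tr(Aⁿ) is an integer congruent to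
-- pⁿ modulo q, forcing q = 1 (likewise for d); then 𝒮(A) = {0} = 𝓛(1, 0, 1/2).
-- Conversely 𝓛(P, Q, R) = 𝒮(A) for A = [[P, −Qb], [1/b, 0]] with b the denominator of R: it has
-- trace P, determinant Q, and b as least common denominator of its entries.

module Submission where

open import Defs
open import Level using (0ℓ)
open import Data.Empty using (⊥-elim)
open import Data.Fin using (zero; suc)
open import Data.List.Base using (_∷_; [])
open import Data.Product using (_×_; _,_; proj₁; proj₂; swap)
open import Relation.Binary.PropositionalEquality
open import Relation.Nullary using (¬_; yes; no)
open import Relation.Nullary.Decidable using (dec⇒maybe)
open import Tactic.RingSolver using (solve-∀)
open import Tactic.RingSolver.Core.AlmostCommutativeRing
  using (AlmostCommutativeRing; fromCommutativeRing)

open import Data.Nat as ℕ using (ℕ; zero; suc; NonZero)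
import Data.Nat.Properties as ℕ
open import Data.Nat.Coprimality as Coprimality using (Coprime; coprime-divisor)
open import Data.Nat.Divisibility using (_∣_; ∣-reflexive; ∣-trans; ∣1⇒≡1; 1∣_)
open import Data.Nat.GCD using (gcd)
open import Data.Nat.LCM using (lcm; m∣lcm[m,n]; n∣lcm[m,n]; lcm-least; gcd*lcm)
open import Data.Integer as ℤ using (ℤ; +_; 0ℤ; 1ℤ)
import Data.Integer.Properties as ℤ
import Data.Integer.Divisibility.Signed as ℤ∣
import Data.Integer.Tactic.RingSolver as ℤ-Tactic
open import Data.Rational as ℚ using (ℚ; mkℚ; _/_; 0ℚ; 1ℚ; ↥_; ↧_; ↧ₙ_)
import Data.Rational.Properties as ℚ
open import Data.Rational.Literals using (fromℤ)
import Data.Rational.Unnormalised as ℚᵘ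
import Data.Rational.Unnormalised.Properties as ℚᵘ

-- The zero test lets the solver normalise literal coefficients such as 0ℚ and 1ℚ.
ℚ-ring : AlmostCommutativeRing 0ℓ 0ℓ
ℚ-ring = fromCommutativeRing ℚ.+-*-commutativeRing (λ x → dec⇒maybe (0ℚ ℚ.≟ x))

-- Integers inside ℚ

/1≡fromℤ : ∀ z → z / 1 ≡ fromℤ z
/1≡fromℤ z = ℚ.↥p/↧p≡p (fromℤ z)

/1-injective : ∀ {a b} → a / 1 ≡ b / 1 → a ≡ b
/1-injective {a} {b} eq = begin
  a            ≡⟨ cong ↥_ (/1≡fromℤ a) ⟨
  ↥ (a / 1)    ≡⟨ cong ↥_ eq ⟩
  ↥ (b / 1)    ≡⟨ cong ↥_ (/1≡fromℤ b) ⟩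
  b            ∎
  where open ≡-Reasoning

toℚᵘ-/1 : ∀ z → ℚ.toℚᵘ (z / 1) ≡ ℚᵘ.mkℚᵘ z 0
toℚᵘ-/1 z = cong ℚ.toℚᵘ (/1≡fromℤ z)

/1-homo-+ : ∀ x y → (x ℤ.+ y) / 1 ≡ x / 1 ℚ.+ y / 1
/1-homo-+ x y = ℚ.toℚᵘ-injective (begin
  ℚ.toℚᵘ ((x ℤ.+ y) / 1)               ≡⟨ toℚᵘ-/1 (x ℤ.+ y) ⟩
  ℚᵘ.mkℚᵘ (x ℤ.+ y) 0                   ≈⟨ ℚᵘ.*≡* cross ⟩
  ℚᵘ.mkℚᵘ x 0 ℚᵘ.+ ℚᵘ.mkℚᵘ y 0          ≡⟨ cong₂ ℚᵘ._+_ (toℚᵘ-/1 x) (toℚᵘ-/1 y) ⟨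
  ℚ.toℚᵘ (x / 1) ℚᵘ.+ ℚ.toℚᵘ (y / 1)    ≈⟨ ℚ.toℚᵘ-homo-+ (x / 1) (y / 1) ⟨
  ℚ.toℚᵘ (x / 1 ℚ.+ y / 1)              ∎)
  where
  open ℚᵘ.≃-Reasoning
  cross : (x ℤ.+ y) ℤ.* + 1 ≡ (x ℤ.* + 1 ℤ.+ y ℤ.* + 1) ℤ.* + 1
  cross = ℤ-Tactic.solve (x ∷ y ∷ [])

/1-homo-* : ∀ x y → (x ℤ.* y) / 1 ≡ (x / 1) ℚ.* (y / 1)
/1-homo-* x y = ℚ.toℚᵘ-injective (begin
  ℚ.toℚᵘ ((x ℤ.* y) / 1)                ≡⟨ toℚᵘ-/1 (x ℤ.* y) ⟩
  ℚᵘ.mkℚᵘ (x ℤ.* y) 0                    ≈⟨ ℚᵘ.*≡* refl ⟩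
  ℚᵘ.mkℚᵘ x 0 ℚᵘ.* ℚᵘ.mkℚᵘ y 0           ≡⟨ cong₂ ℚᵘ._*_ (toℚᵘ-/1 x) (toℚᵘ-/1 y) ⟨
  ℚ.toℚᵘ (x / 1) ℚᵘ.* ℚ.toℚᵘ (y / 1)     ≈⟨ ℚ.toℚᵘ-homo-* (x / 1) (y / 1) ⟨
  ℚ.toℚᵘ ((x / 1) ℚ.* (y / 1))           ∎)
  where open ℚᵘ.≃-Reasoning

/1-homo‿- : ∀ x → (ℤ.- x) / 1 ≡ ℚ.- (x / 1)
/1-homo‿- x = ℚ.toℚᵘ-injective (begin
  ℚ.toℚᵘ ((ℤ.- x) / 1)    ≡⟨ toℚᵘ-/1 (ℤ.- x) ⟩
  ℚᵘ.mkℚᵘ (ℤ.- x) 0        ≡⟨ cong ℚᵘ.-_ (toℚᵘ-/1 x) ⟨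
  ℚᵘ.- ℚ.toℚᵘ (x / 1)      ≈⟨ ℚ.toℚᵘ-homo‿- (x / 1) ⟨
  ℚ.toℚᵘ (ℚ.- (x / 1))     ∎)
  where open ℚᵘ.≃-Reasoning

/1-homo-- : ∀ x y → (x ℤ.- y) / 1 ≡ x / 1 ℚ.- y / 1
/1-homo-- x y = trans (/1-homo-+ x (ℤ.- y)) (cong (x / 1 ℚ.+_) (/1-homo‿- y))

p*↧p≡↥p : ∀ p → p ℚ.* (↧ p / 1) ≡ ↥ p / 1
p*↧p≡↥p p@(mkℚ n d _) = ℚ.toℚᵘ-injective (begin
  ℚ.toℚᵘ (p ℚ.* (↧ p / 1))                ≈⟨ ℚ.toℚᵘ-homo-* p (↧ p / 1) ⟩
  ℚᵘ.mkℚᵘ n d ℚᵘ.* ℚ.toℚᵘ (↧ p / 1)       ≡⟨ cong (ℚᵘ.mkℚᵘ n d ℚᵘ.*_) (toℚᵘ-/1 (↧ p)) ⟩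
  ℚᵘ.mkℚᵘ n d ℚᵘ.* ℚᵘ.mkℚᵘ (↧ p) 0        ≈⟨ ℚᵘ.*≡* cross ⟩
  ℚᵘ.mkℚᵘ n 0                              ≡⟨ toℚᵘ-/1 n ⟨
  ℚ.toℚᵘ (↥ p / 1)                         ∎)
  where
  open ℚᵘ.≃-Reasoning
  cross : (n ℤ.* ↧ p) ℤ.* + 1 ≡ n ℤ.* + (suc d ℕ.* 1)
  cross = trans (ℤ.*-identityʳ _) (cong (λ m → n ℤ.* + m) (sym (ℕ.*-identityʳ (suc d))))

↥-coprime-↧ : ∀ p → Coprime ℤ.∣ ↥ p ∣ (↧ₙ p)
↥-coprime-↧ (mkℚ _ _ c) = Coprimality.recompute c

isInteger-/1 : ∀ z → IsInteger (z / 1)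
isInteger-/1 z = z , refl

isInteger-+ : ∀ {p q} → IsInteger p → IsInteger q → IsInteger (p ℚ.+ q)
isInteger-+ (a , refl) (b , refl) = a ℤ.+ b , sym (/1-homo-+ a b)

isInteger-* : ∀ {p q} → IsInteger p → IsInteger q → IsInteger (p ℚ.* q)
isInteger-* (a , refl) (b , refl) = a ℤ.* b , sym (/1-homo-* a b)

isInteger-neg : ∀ {p} → IsInteger p → IsInteger (ℚ.- p)
isInteger-neg (a , refl) = ℤ.- a , sym (/1-homo‿- a)

isInteger-- : ∀ {p q} → IsInteger p → IsInteger q → IsInteger (p ℚ.- q)
isInteger-- ip iq = isInteger-+ ip (isInteger-neg iq)

isInteger-I2 : IsIntegerMatrix I2
isInteger-I2 zero       zero       = 1ℤ , refl
isInteger-I2 zero       (suc zero) = 0ℤ , refl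
isInteger-I2 (suc zero) zero       = 0ℤ , refl
isInteger-I2 (suc zero) (suc zero) = 1ℤ , refl

↧∣⇒isInteger-* : ∀ z p → ↧ₙ p ∣ ℤ.∣ z ∣ → IsInteger ((z / 1) ℚ.* p)
↧∣⇒isInteger-* z p ↧p∣z with ℤ∣.∣ᵤ⇒∣ {↧ p} {z} ↧p∣z
... | ℤ∣.divides w refl = w ℤ.* ↥ p , (begin
  ((w ℤ.* ↧ p) / 1) ℚ.* p          ≡⟨ cong (ℚ._* p) (/1-homo-* w (↧ p)) ⟩
  (w / 1) ℚ.* (↧ p / 1) ℚ.* p      ≡⟨ regroup (w / 1) (↧ p / 1) p ⟩
  (w / 1) ℚ.* (p ℚ.* (↧ p / 1))    ≡⟨ cong ((w / 1) ℚ.*_) (p*↧p≡↥p p) ⟩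
  (w / 1) ℚ.* (↥ p / 1)            ≡⟨ /1-homo-* w (↥ p) ⟨
  (w ℤ.* ↥ p) / 1                  ∎)
  where
  open ≡-Reasoning
  regroup : ∀ a b c → a ℚ.* b ℚ.* c ≡ a ℚ.* (c ℚ.* b)
  regroup = solve-∀ ℚ-ring

isInteger-*⇒↧∣ : ∀ z p → IsInteger ((z / 1) ℚ.* p) → ↧ₙ p ∣ ℤ.∣ z ∣
isInteger-*⇒↧∣ z p (w , z*p≡w) =
  coprime-divisor (Coprimality.sym (↥-coprime-↧ p)) (subst (↧ₙ p ∣_) reorder ↧p∣z*↥p)
  where
  open ≡-Reasoning
  regroup : ∀ a b c → a ℚ.* (b ℚ.* c) ≡ a ℚ.* b ℚ.* c
  regroup = solve-∀ ℚ-ring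
  z*↥p≡w*↧p : z ℤ.* ↥ p ≡ w ℤ.* ↧ p
  z*↥p≡w*↧p = /1-injective (begin
    (z ℤ.* ↥ p) / 1                 ≡⟨ /1-homo-* z (↥ p) ⟩
    (z / 1) ℚ.* (↥ p / 1)           ≡⟨ cong ((z / 1) ℚ.*_) (p*↧p≡↥p p) ⟨
    (z / 1) ℚ.* (p ℚ.* (↧ p / 1))   ≡⟨ regroup (z / 1) p (↧ p / 1) ⟩
    (z / 1) ℚ.* p ℚ.* (↧ p / 1)     ≡⟨ cong (ℚ._* (↧ p / 1)) z*p≡w ⟩
    (w / 1) ℚ.* (↧ p / 1)           ≡⟨ /1-homo-* w (↧ p) ⟨
    (w ℤ.* ↧ p) / 1                 ∎)
  ↧p∣z*↥p : ↧ₙ p ∣ ℤ.∣ z ℤ.* ↥ p ∣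
  ↧p∣z*↥p = ℤ∣.∣⇒∣ᵤ (ℤ∣.divides w z*↥p≡w*↧p)
  reorder : ℤ.∣ z ℤ.* ↥ p ∣ ≡ ℤ.∣ ↥ p ∣ ℕ.* ℤ.∣ z ∣
  reorder = trans (ℤ.abs-* z (↥ p)) (ℕ.*-comm ℤ.∣ z ∣ ℤ.∣ ↥ p ∣)

isInteger⇒↧∣ : ∀ {p} m → IsInteger p → ↧ₙ p ∣ m
isInteger⇒↧∣ {p} m ip = ∣-trans ↧p∣1 (1∣ m)
  where
  ↧p∣1 : ↧ₙ p ∣ 1
  ↧p∣1 = isInteger-*⇒↧∣ 1ℤ p (subst IsInteger (sym (ℚ.*-identityˡ p)) ip)

↧ₙ≡1⇒≡↥/1 : ∀ p → ↧ₙ p ≡ 1 → p ≡ ↥ p / 1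
↧ₙ≡1⇒≡↥/1 p ↧p≡1 = begin
  p                   ≡⟨ ℚ.*-identityʳ p ⟨
  p ℚ.* (+ 1 / 1)     ≡⟨ cong (λ n → p ℚ.* (+ n / 1)) ↧p≡1 ⟨
  p ℚ.* (↧ p / 1)     ≡⟨ p*↧p≡↥p p ⟩
  ↥ p / 1             ∎
  where open ≡-Reasoning

coprime-∣^⇒≡1 : ∀ {d m} k → Coprime d m → d ∣ m ℕ.^ k → d ≡ 1
coprime-∣^⇒≡1 zero    _ d∣1     = ∣1⇒≡1 d∣1
coprime-∣^⇒≡1 (suc k) c d∣m*m^k = coprime-∣^⇒≡1 k c (coprime-divisor c d∣m*m^k)

abs-^ : ∀ i k → ℤ.∣ i ℤ.^ k ∣ ≡ ℤ.∣ i ∣ ℕ.^ k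
abs-^ i zero    = refl
abs-^ i (suc k) = trans (ℤ.abs-* i (i ℤ.^ k)) (cong (ℤ.∣ i ∣ ℕ.*_) (abs-^ i k))

↧∣↥^⇒↧≡1 : ∀ p k → ↧ p ℤ∣.∣ ↥ p ℤ.^ k → ↧ₙ p ≡ 1
↧∣↥^⇒↧≡1 p k ↧∣↥^ = coprime-∣^⇒≡1 k (Coprimality.sym (↥-coprime-↧ p))
  (subst (↧ₙ p ∣_) (abs-^ (↥ p) k) (ℤ∣.∣⇒∣ᵤ ↧∣↥^))

-- Second-order linear recurrences

record Recurrent (t d : ℚ) (x : ℕ → ℚ) : Set where
  constructor recurrent
  field step : ∀ n → x (suc (suc n)) ≡ t ℚ.* x (suc n) ℚ.- d ℚ.* x n

open Recurrent

module _ {t d : ℚ} where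

  recurrent-unique : ∀ {x y} → Recurrent t d x → Recurrent t d y →
                     x 0 ≡ y 0 → x 1 ≡ y 1 → ∀ n → x n ≡ y n
  recurrent-unique         rx ry x0≡y0 x1≡y1 zero          = x0≡y0
  recurrent-unique         rx ry x0≡y0 x1≡y1 (suc zero)    = x1≡y1
  recurrent-unique {x} {y} rx ry x0≡y0 x1≡y1 (suc (suc n)) = begin
    x (suc (suc n))                      ≡⟨ step rx n ⟩
    t ℚ.* x (suc n) ℚ.- d ℚ.* x n        ≡⟨ cong₂ (λ a b → t ℚ.* a ℚ.- d ℚ.* b) (x≡y (suc n)) (x≡y n) ⟩
    t ℚ.* y (suc n) ℚ.- d ℚ.* y n        ≡⟨ step ry n ⟨
    y (suc (suc n))                      ∎
    where
    open ≡-Reasoning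
    x≡y : ∀ n → x n ≡ y n
    x≡y = recurrent-unique rx ry x0≡y0 x1≡y1

  recurrent-+ : ∀ {x y} → Recurrent t d x → Recurrent t d y → Recurrent t d (λ n → x n ℚ.+ y n)
  recurrent-+ {x} {y} rx ry = recurrent λ n →
    trans (cong₂ ℚ._+_ (step rx n) (step ry n)) (collect t d (x (suc n)) (x n) (y (suc n)) (y n))
    where
    collect : ∀ a b x₁ x₀ y₁ y₀ →
              (a ℚ.* x₁ ℚ.- b ℚ.* x₀) ℚ.+ (a ℚ.* y₁ ℚ.- b ℚ.* y₀) ≡ a ℚ.* (x₁ ℚ.+ y₁) ℚ.- b ℚ.* (x₀ ℚ.+ y₀)
    collect = solve-∀ ℚ-ring

  recurrent-combination : ∀ {x y} → Recurrent t d x → Recurrent t d y →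
                          ∀ α β → Recurrent t d (λ n → x n ℚ.* α ℚ.- y n ℚ.* β)
  recurrent-combination {x} {y} rx ry α β = recurrent λ n →
    trans (cong₂ (λ a b → a ℚ.* α ℚ.- b ℚ.* β) (step rx n) (step ry n))
          (collect t d (x (suc n)) (x n) (y (suc n)) (y n) α β)
    where
    collect : ∀ a b x₁ x₀ y₁ y₀ α β →
              (a ℚ.* x₁ ℚ.- b ℚ.* x₀) ℚ.* α ℚ.- (a ℚ.* y₁ ℚ.- b ℚ.* y₀) ℚ.* β
                ≡ a ℚ.* (x₁ ℚ.* α ℚ.- y₁ ℚ.* β) ℚ.- b ℚ.* (x₀ ℚ.* α ℚ.- y₀ ℚ.* β)
    collect = solve-∀ ℚ-ring

  recurrent-scale : ∀ {x} → Recurrent t d x → ∀ r →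
                    Recurrent (t ℚ.* (r / 1)) (d ℚ.* ((r ℤ.* r) / 1)) (λ n → x n ℚ.* ((r ℤ.^ n) / 1))
  recurrent-scale {x} rx r = recurrent scaled
    where
    regroup : ∀ a b x₁ x₀ ρ w →
              (a ℚ.* x₁ ℚ.- b ℚ.* x₀) ℚ.* (ρ ℚ.* (ρ ℚ.* w))
                ≡ (a ℚ.* ρ) ℚ.* (x₁ ℚ.* (ρ ℚ.* w)) ℚ.- (b ℚ.* (ρ ℚ.* ρ)) ℚ.* (x₀ ℚ.* w)
    regroup = solve-∀ ℚ-ring
    scaled : ∀ n → x (suc (suc n)) ℚ.* ((r ℤ.^ suc (suc n)) / 1)
                     ≡ (t ℚ.* (r / 1)) ℚ.* (x (suc n) ℚ.* ((r ℤ.^ suc n) / 1))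
                       ℚ.- (d ℚ.* ((r ℤ.* r) / 1)) ℚ.* (x n ℚ.* ((r ℤ.^ n) / 1))
    scaled n = begin
      x (suc (suc n)) ℚ.* ((r ℤ.* (r ℤ.* r ℤ.^ n)) / 1)
        ≡⟨ cong₂ ℚ._*_ (step rx n) (trans (/1-homo-* r _) (cong (ρ ℚ.*_) (/1-homo-* r (r ℤ.^ n)))) ⟩
      (t ℚ.* x (suc n) ℚ.- d ℚ.* x n) ℚ.* (ρ ℚ.* (ρ ℚ.* w))
        ≡⟨ regroup t d (x (suc n)) (x n) ρ w ⟩
      (t ℚ.* ρ) ℚ.* (x (suc n) ℚ.* (ρ ℚ.* w)) ℚ.- (d ℚ.* (ρ ℚ.* ρ)) ℚ.* (x n ℚ.* w)
        ≡⟨ cong₂ (λ a b → (t ℚ.* ρ) ℚ.* (x (suc n) ℚ.* a) ℚ.- (d ℚ.* b) ℚ.* (x n ℚ.* w))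
                 (/1-homo-* r (r ℤ.^ n)) (/1-homo-* r r) ⟨
      (t ℚ.* ρ) ℚ.* (x (suc n) ℚ.* ((r ℤ.* r ℤ.^ n) / 1)) ℚ.- (d ℚ.* ((r ℤ.* r) / 1)) ℚ.* (x n ℚ.* w)
        ∎
      where
      open ≡-Reasoning
      ρ w : ℚ
      ρ = r / 1
      w = (r ℤ.^ n) / 1

/1-recurrent : ∀ {P Q} {σ : ℕ → ℤ} → (∀ n → σ (suc (suc n)) ≡ P ℤ.* σ (suc n) ℤ.- Q ℤ.* σ n) →
               Recurrent (P / 1) (Q / 1) (λ n → σ n / 1)
/1-recurrent {P} {Q} {σ} rσ = recurrent λ n → begin
  σ (suc (suc n)) / 1                                ≡⟨ cong (_/ 1) (rσ n) ⟩
  (P ℤ.* σ (suc n) ℤ.- Q ℤ.* σ n) / 1                ≡⟨ /1-homo-- (P ℤ.* σ (suc n)) (Q ℤ.* σ n) ⟩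
  (P ℤ.* σ (suc n)) / 1 ℚ.- (Q ℤ.* σ n) / 1          ≡⟨ cong₂ ℚ._-_ (/1-homo-* P (σ (suc n))) (/1-homo-* Q (σ n)) ⟩
  (P / 1) ℚ.* (σ (suc n) / 1) ℚ.- (Q / 1) ℚ.* (σ n / 1) ∎
  where open ≡-Reasoning

lucas-recurrent : ∀ P Q → Recurrent (P / 1) (Q / 1) (λ n → U P Q n / 1)
lucas-recurrent P Q = /1-recurrent {P} {Q} {U P Q} (λ _ → refl)

recurrent-via-lucas : ∀ {P Q x} → Recurrent (P / 1) (Q / 1) x →
  ∀ n → x (suc n) ≡ (U P Q (suc n) / 1) ℚ.* x 1 ℚ.- (U P Q n / 1) ℚ.* ((Q / 1) ℚ.* x 0)
recurrent-via-lucas {P} {Q} {x} rx = recurrent-unique (recurrent λ n → step rx (suc n)) combination at-0 at-1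
  where
  open ≡-Reasoning
  combination : Recurrent (P / 1) (Q / 1)
                  (λ n → (U P Q (suc n) / 1) ℚ.* x 1 ℚ.- (U P Q n / 1) ℚ.* ((Q / 1) ℚ.* x 0))
  combination = recurrent-combination (recurrent λ n → step (lucas-recurrent P Q) (suc n)) (lucas-recurrent P Q)
                                      (x 1) ((Q / 1) ℚ.* x 0)
  at-0 : x 1 ≡ 1ℚ ℚ.* x 1 ℚ.- 0ℚ ℚ.* ((Q / 1) ℚ.* x 0)
  at-0 = unit (x 1) ((Q / 1) ℚ.* x 0)
    where
    unit : ∀ a b → a ≡ 1ℚ ℚ.* a ℚ.- 0ℚ ℚ.* b
    unit = solve-∀ ℚ-ring
  at-1 : x 2 ≡ (U P Q 2 / 1) ℚ.* x 1 ℚ.- 1ℚ ℚ.* ((Q / 1) ℚ.* x 0)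
  at-1 = begin
    x 2
      ≡⟨ step rx 0 ⟩
    (P / 1) ℚ.* x 1 ℚ.- (Q / 1) ℚ.* x 0
      ≡⟨ unit (P / 1) (Q / 1) (x 1) (x 0) ⟩
    (P / 1) ℚ.* x 1 ℚ.- 1ℚ ℚ.* ((Q / 1) ℚ.* x 0)
      ≡⟨ cong (λ u → (u / 1) ℚ.* x 1 ℚ.- 1ℚ ℚ.* ((Q / 1) ℚ.* x 0)) U₂≡P ⟨
    (U P Q 2 / 1) ℚ.* x 1 ℚ.- 1ℚ ℚ.* ((Q / 1) ℚ.* x 0)
      ∎
    where
    unit : ∀ p q a b → p ℚ.* a ℚ.- q ℚ.* b ≡ p ℚ.* a ℚ.- 1ℚ ℚ.* (q ℚ.* b)
    unit = solve-∀ ℚ-ring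
    U₂≡P : U P Q 2 ≡ P
    U₂≡P = lucas₂ P Q
      where
      lucas₂ : ∀ p q → p ℤ.* 1ℤ ℤ.- q ℤ.* 0ℤ ≡ p
      lucas₂ = ℤ-Tactic.solve-∀

module _ {t : ℚ} {c s₀ : ℤ} {s : ℕ → ℚ}
         (rs : Recurrent t (c / 1) s) (s-0 : s 0 ≡ s₀ / 1) (s-1 : s 1 ≡ t) where

  private
    p q : ℤ
    p = ↥ t
    q = ↧ t

    -- σ n = qⁿ s n, an integer sequence congruent to pⁿ modulo q.
    σ : ℕ → ℤ
    σ zero          = s₀
    σ (suc zero)    = p
    σ (suc (suc n)) = p ℤ.* σ (suc n) ℤ.- (c ℤ.* (q ℤ.* q)) ℤ.* σ n

    s*q^≡σ : ∀ n → s n ℚ.* ((q ℤ.^ n) / 1) ≡ σ n / 1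
    s*q^≡σ = recurrent-unique scaled (/1-recurrent {p} {c ℤ.* (q ℤ.* q)} {σ} (λ _ → refl)) at-0 at-1
      where
      scaled : Recurrent (p / 1) ((c ℤ.* (q ℤ.* q)) / 1) (λ n → s n ℚ.* ((q ℤ.^ n) / 1))
      scaled = subst₂ (λ a b → Recurrent a b (λ n → s n ℚ.* ((q ℤ.^ n) / 1)))
                      (p*↧p≡↥p t) (sym (/1-homo-* c (q ℤ.* q))) (recurrent-scale rs q)
      at-0 : s 0 ℚ.* 1ℚ ≡ s₀ / 1
      at-0 = trans (ℚ.*-identityʳ (s 0)) s-0
      at-1 : s 1 ℚ.* ((q ℤ.* 1ℤ) / 1) ≡ p / 1
      at-1 = trans (cong₂ (λ a b → a ℚ.* (b / 1)) s-1 (ℤ.*-identityʳ q)) (p*↧p≡↥p t)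

    q∣σ-p^ : ∀ n → q ℤ∣.∣ σ (suc n) ℤ.- p ℤ.^ suc n
    q∣σ-p^ zero    = ℤ∣.divides 0ℤ (vanish p q)
      where
      vanish : ∀ a b → a ℤ.- a ℤ.* 1ℤ ≡ 0ℤ ℤ.* b
      vanish = ℤ-Tactic.solve-∀
    q∣σ-p^ (suc n) = subst (q ℤ∣.∣_) (regroup p (σ (suc n)) (p ℤ.^ suc n) c q (σ n))
      (ℤ∣.∣m∣n⇒∣m-n (ℤ∣.∣n⇒∣m*n p (q∣σ-p^ n))
                    (ℤ∣.∣m⇒∣m*n (σ n) (ℤ∣.∣n⇒∣m*n c (ℤ∣.∣m⇒∣m*n q ℤ∣.∣-refl))))
      where
      regroup : ∀ a x₁ y e b x₀ → a ℤ.* (x₁ ℤ.- y) ℤ.- (e ℤ.* (b ℤ.* b)) ℤ.* x₀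
                                    ≡ (a ℤ.* x₁ ℤ.- (e ℤ.* (b ℤ.* b)) ℤ.* x₀) ℤ.- a ℤ.* y
      regroup = ℤ-Tactic.solve-∀

  recurrent-isInteger⇒↧≡1 : ∀ k → IsInteger (s (suc k)) → ↧ₙ t ≡ 1
  recurrent-isInteger⇒↧≡1 k (w , s≡w) = ↧∣↥^⇒↧≡1 t (suc k) q∣p^
    where
    open ≡-Reasoning
    σ≡w*q^ : σ (suc k) ≡ w ℤ.* q ℤ.^ suc k
    σ≡w*q^ = /1-injective (begin
      σ (suc k) / 1                         ≡⟨ s*q^≡σ (suc k) ⟨
      s (suc k) ℚ.* ((q ℤ.^ suc k) / 1)     ≡⟨ cong (ℚ._* ((q ℤ.^ suc k) / 1)) s≡w ⟩
      (w / 1) ℚ.* ((q ℤ.^ suc k) / 1)       ≡⟨ /1-homo-* w (q ℤ.^ suc k) ⟨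
      (w ℤ.* q ℤ.^ suc k) / 1               ∎)
    q∣σ : q ℤ∣.∣ σ (suc k)
    q∣σ = subst (q ℤ∣.∣_) (sym σ≡w*q^) (ℤ∣.∣n⇒∣m*n w (ℤ∣.∣m⇒∣m*n (q ℤ.^ k) ℤ∣.∣-refl))
    cancel : ∀ a b → a ℤ.- (a ℤ.- b) ≡ b
    cancel = ℤ-Tactic.solve-∀
    q∣p^ : q ℤ∣.∣ p ℤ.^ suc k
    q∣p^ = subst (q ℤ∣.∣_) (cancel (σ (suc k)) (p ℤ.^ suc k)) (ℤ∣.∣m∣n⇒∣m-n q∣σ (q∣σ-p^ k))

-- 2 × 2 matrices

trace : Mat2 → ℚ
trace A = A zero zero ℚ.+ A (suc zero) (suc zero)

det : Mat2 → ℚ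
det A = A zero zero ℚ.* A (suc zero) (suc zero) ℚ.- A zero (suc zero) ℚ.* A (suc zero) zero

⊗-identityʳ : ∀ A i j → (A ⊗ I2) i j ≡ A i j
⊗-identityʳ A i zero       = first (A i zero) (A i (suc zero))
  where
  first : ∀ a b → a ℚ.* 1ℚ ℚ.+ b ℚ.* 0ℚ ≡ a
  first = solve-∀ ℚ-ring
⊗-identityʳ A i (suc zero) = second (A i zero) (A i (suc zero))
  where
  second : ∀ a b → a ℚ.* 0ℚ ℚ.+ b ℚ.* 1ℚ ≡ b
  second = solve-∀ ℚ-ring

det-⊗ : ∀ A B → det (A ⊗ B) ≡ det A ℚ.* det B
det-⊗ A B = multiplicative (A zero zero) (A zero (suc zero)) (A (suc zero) zero) (A (suc zero) (suc zero))
                           (B zero zero) (B zero (suc zero)) (B (suc zero) zero) (B (suc zero) (suc zero))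
  where
  multiplicative : ∀ a b c d a' b' c' d' →
    (a ℚ.* a' ℚ.+ b ℚ.* c') ℚ.* (c ℚ.* b' ℚ.+ d ℚ.* d') ℚ.- (a ℚ.* b' ℚ.+ b ℚ.* d') ℚ.* (c ℚ.* a' ℚ.+ d ℚ.* c')
      ≡ (a ℚ.* d ℚ.- b ℚ.* c) ℚ.* (a' ℚ.* d' ℚ.- b' ℚ.* c')
  multiplicative = solve-∀ ℚ-ring

cayley-hamilton : ∀ A X i j → (A ⊗ (A ⊗ X)) i j ≡ trace A ℚ.* (A ⊗ X) i j ℚ.- det A ℚ.* X i j
cayley-hamilton A X zero j =
  first (A zero zero) (A zero (suc zero)) (A (suc zero) zero) (A (suc zero) (suc zero)) (X zero j) (X (suc zero) j)
  where
  first : ∀ a b c d x y →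
    a ℚ.* (a ℚ.* x ℚ.+ b ℚ.* y) ℚ.+ b ℚ.* (c ℚ.* x ℚ.+ d ℚ.* y)
      ≡ (a ℚ.+ d) ℚ.* (a ℚ.* x ℚ.+ b ℚ.* y) ℚ.- (a ℚ.* d ℚ.- b ℚ.* c) ℚ.* x
  first = solve-∀ ℚ-ring
cayley-hamilton A X (suc zero) j =
  second (A zero zero) (A zero (suc zero)) (A (suc zero) zero) (A (suc zero) (suc zero)) (X zero j) (X (suc zero) j)
  where
  second : ∀ a b c d x y →
    c ℚ.* (a ℚ.* x ℚ.+ b ℚ.* y) ℚ.+ d ℚ.* (c ℚ.* x ℚ.+ d ℚ.* y)
      ≡ (a ℚ.+ d) ℚ.* (c ℚ.* x ℚ.+ d ℚ.* y) ℚ.- (a ℚ.* d ℚ.- b ℚ.* c) ℚ.* y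
  second = solve-∀ ℚ-ring

isInteger-trace : ∀ {A} → IsIntegerMatrix A → IsInteger (trace A)
isInteger-trace iA = isInteger-+ (iA zero zero) (iA (suc zero) (suc zero))

isInteger-det : ∀ {A} → IsIntegerMatrix A → IsInteger (det A)
isInteger-det iA = isInteger-- (isInteger-* (iA zero zero) (iA (suc zero) (suc zero)))
                               (isInteger-* (iA zero (suc zero)) (iA (suc zero) zero))

^-recurrent : ∀ A i j → Recurrent (trace A) (det A) (λ n → (A ^ n) i j)
^-recurrent A i j = recurrent λ n → cayley-hamilton A (A ^ n) i j

trace-^-recurrent : ∀ A → Recurrent (trace A) (det A) (λ n → trace (A ^ n))
trace-^-recurrent A = recurrent-+ (^-recurrent A zero zero) (^-recurrent A (suc zero) (suc zero))

det-^-recurrent : ∀ A → Recurrent (det A) 0ℚ (λ n → det (A ^ n))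
det-^-recurrent A = recurrent λ n →
  trans (det-⊗ A (A ^ suc n)) (minus-zero (det A ℚ.* det (A ^ suc n)) (det (A ^ n)))
  where
  minus-zero : ∀ a b → a ≡ a ℚ.- 0ℚ ℚ.* b
  minus-zero = solve-∀ ℚ-ring

𝒮-suc⇒det-integral : ∀ A k → 𝒮 A (suc k) → ↧ₙ (det A) ≡ 1
𝒮-suc⇒det-integral A k iA^ =
  recurrent-isInteger⇒↧≡1 {c = 0ℤ} {s₀ = 1ℤ} (det-^-recurrent A) refl det-A¹ k (isInteger-det iA^)
  where
  det-A¹ : det (A ^ 1) ≡ det A
  det-A¹ = trans (det-⊗ A I2) (ℚ.*-identityʳ (det A))

𝒮-suc⇒trace-integral : ∀ A {D} k → det A ≡ D / 1 → 𝒮 A (suc k) → ↧ₙ (trace A) ≡ 1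
𝒮-suc⇒trace-integral A {D} k detA iA^ =
  recurrent-isInteger⇒↧≡1 {c = D} {s₀ = + 2} recurrence refl trace-A¹ k (isInteger-trace iA^)
  where
  recurrence : Recurrent (trace A) (D / 1) (λ n → trace (A ^ n))
  recurrence = subst (λ d → Recurrent (trace A) d (λ n → trace (A ^ n))) detA (trace-^-recurrent A)
  trace-A¹ : trace (A ^ 1) ≡ trace A
  trace-A¹ = cong₂ ℚ._+_ (⊗-identityʳ A zero zero) (⊗-identityʳ A (suc zero) (suc zero))

-- Matrices with integral trace and determinant

record LeastCommonDenominator (A : Mat2) (ℓ : ℕ) : Set where
  field
    common : ∀ i j → ↧ₙ (A i j) ∣ ℓ
    least  : ∀ {m} → (∀ i j → ↧ₙ (A i j) ∣ m) → ℓ ∣ m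

open LeastCommonDenominator

lucas-zero : ∀ P Q R → Lucas P Q R 0
lucas-zero P Q R = 0ℤ , ℚ.*-zeroˡ R

module _ {A : Mat2} {P Q : ℤ} (traceA : trace A ≡ P / 1) (detA : det A ≡ Q / 1) where

  ^-suc≡lucas : ∀ n i j →
    (A ^ suc n) i j ≡ (U P Q (suc n) / 1) ℚ.* A i j ℚ.- (U P Q n / 1) ℚ.* ((Q / 1) ℚ.* I2 i j)
  ^-suc≡lucas n i j = trans (recurrent-via-lucas recurrence n)
    (cong (λ a → (U P Q (suc n) / 1) ℚ.* a ℚ.- (U P Q n / 1) ℚ.* ((Q / 1) ℚ.* I2 i j)) (⊗-identityʳ A i j))
    where
    recurrence : Recurrent (P / 1) (Q / 1) (λ n → (A ^ n) i j)
    recurrence = subst₂ (λ t d → Recurrent t d (λ n → (A ^ n) i j)) traceA detA (^-recurrent A i j)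

  private
    isInteger-U*Q*I : ∀ n i j → IsInteger ((U P Q n / 1) ℚ.* ((Q / 1) ℚ.* I2 i j))
    isInteger-U*Q*I n i j = isInteger-* (isInteger-/1 (U P Q n)) (isInteger-* (isInteger-/1 Q) (isInteger-I2 i j))

  𝒮-suc⇒isInteger-U*A : ∀ n → 𝒮 A (suc n) → ∀ i j → IsInteger ((U P Q (suc n) / 1) ℚ.* A i j)
  𝒮-suc⇒isInteger-U*A n iA^ i j = subst IsInteger (cancel _ _)
    (isInteger-+ (subst IsInteger (^-suc≡lucas n i j) (iA^ i j)) (isInteger-U*Q*I n i j))
    where
    cancel : ∀ a b → a ℚ.- b ℚ.+ b ≡ a
    cancel = solve-∀ ℚ-ring

  isInteger-U*A⇒𝒮-suc : ∀ n → (∀ i j → IsInteger ((U P Q (suc n) / 1) ℚ.* A i j)) → 𝒮 A (suc n)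
  isInteger-U*A⇒𝒮-suc n iUA i j =
    subst IsInteger (sym (^-suc≡lucas n i j)) (isInteger-- (iUA i j) (isInteger-U*Q*I n i j))

  𝒮≐Lucas : ∀ {R} → LeastCommonDenominator A (↧ₙ R) → 𝒮 A ≐ Lucas P Q R
  𝒮≐Lucas {R} lcd zero    = (λ _ → lucas-zero P Q R) , (λ _ → isInteger-I2)
  𝒮≐Lucas {R} lcd (suc n) = to , from
    where
    Uₙ₊₁ : ℤ
    Uₙ₊₁ = U P Q (suc n)
    to : 𝒮 A (suc n) → Lucas P Q R (suc n)
    to iA^ = ↧∣⇒isInteger-* Uₙ₊₁ R
      (least lcd (λ i j → isInteger-*⇒↧∣ Uₙ₊₁ (A i j) (𝒮-suc⇒isInteger-U*A n iA^ i j)))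
    from : Lucas P Q R (suc n) → 𝒮 A (suc n)
    from iUR = isInteger-U*A⇒𝒮-suc n λ i j →
      ↧∣⇒isInteger-* Uₙ₊₁ (A i j) (∣-trans (common lcd i j) (isInteger-*⇒↧∣ Uₙ₊₁ R iUR))

-- Unlike + 1 / n, its numerator and denominator are available by computation.
1/ₙ : (n : ℕ) → .{{NonZero n}} → ℚ
1/ₙ (suc m) = mkℚ (+ 1) m (Coprimality.1-coprimeTo (suc m))

↧ₙ-1/ₙ : ∀ n .{{_ : NonZero n}} → ↧ₙ (1/ₙ n) ≡ n
↧ₙ-1/ₙ (suc m) = refl

↥-1/ₙ : ∀ n .{{_ : NonZero n}} → ↥ (1/ₙ n) ≡ 1ℤ
↥-1/ₙ (suc m) = refl

lcm-nonZero : ∀ m n .{{_ : NonZero m}} .{{_ : NonZero n}} → NonZero (lcm m n)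
lcm-nonZero m n = ℕ.m*n≢0⇒n≢0 (gcd m n) {{subst NonZero (sym (gcd*lcm m n)) (ℕ.m*n≢0 m n)}}

module _ (A : Mat2) where

  private
    d₀₀ d₀₁ d₁₀ d₁₁ : ℕ
    d₀₀ = ↧ₙ A zero zero
    d₀₁ = ↧ₙ A zero (suc zero)
    d₁₀ = ↧ₙ A (suc zero) zero
    d₁₁ = ↧ₙ A (suc zero) (suc zero)

  denominatorLcm : ℕ
  denominatorLcm = lcm (lcm d₀₀ d₀₁) (lcm d₁₀ d₁₁)

  denominatorLcm-nonZero : NonZero denominatorLcm
  denominatorLcm-nonZero =
    lcm-nonZero (lcm d₀₀ d₀₁) (lcm d₁₀ d₁₁) {{lcm-nonZero d₀₀ d₀₁}} {{lcm-nonZero d₁₀ d₁₁}}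

  denominatorLcm-least : LeastCommonDenominator A denominatorLcm
  denominatorLcm-least = record
    { common = λ where
        zero       zero       → ∣-trans (m∣lcm[m,n] d₀₀ d₀₁) (m∣lcm[m,n] (lcm d₀₀ d₀₁) (lcm d₁₀ d₁₁))
        zero       (suc zero) → ∣-trans (n∣lcm[m,n] d₀₀ d₀₁) (m∣lcm[m,n] (lcm d₀₀ d₀₁) (lcm d₁₀ d₁₁))
        (suc zero) zero       → ∣-trans (m∣lcm[m,n] d₁₀ d₁₁) (n∣lcm[m,n] (lcm d₀₀ d₀₁) (lcm d₁₀ d₁₁))
        (suc zero) (suc zero) → ∣-trans (n∣lcm[m,n] d₁₀ d₁₁) (n∣lcm[m,n] (lcm d₀₀ d₀₁) (lcm d₁₀ d₁₁))
    ; least = λ ↧∣m → lcm-least (lcm-least (↧∣m zero zero) (↧∣m zero (suc zero)))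
                                (lcm-least (↧∣m (suc zero) zero) (↧∣m (suc zero) (suc zero)))
    }

lucas-1-0-suc : ∀ n → U (+ 1) 0ℤ (suc n) ≡ 1ℤ
lucas-1-0-suc zero    = refl
lucas-1-0-suc (suc n) rewrite lucas-1-0-suc n = refl

¬lucas-1-0-½-suc : ∀ n → ¬ Lucas (+ 1) 0ℤ (1/ₙ 2) (suc n)
¬lucas-1-0-½-suc n iU½ = 2≢1 (∣1⇒≡1 2∣1)
  where
  2≢1 : 2 ≢ 1
  2≢1 ()
  2∣1 : 2 ∣ 1
  2∣1 = subst (2 ∣_) (cong ℤ.∣_∣ (lucas-1-0-suc n)) (isInteger-*⇒↧∣ (U (+ 1) 0ℤ (suc n)) (1/ₙ 2) iU½)

𝒮≐Lucas-1-0-½ : ∀ A → (∀ k → ¬ 𝒮 A (suc k)) → 𝒮 A ≐ Lucas (+ 1) 0ℤ (1/ₙ 2)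
𝒮≐Lucas-1-0-½ A ¬𝒮 zero    = (λ _ → lucas-zero (+ 1) 0ℤ (1/ₙ 2)) , (λ _ → isInteger-I2)
𝒮≐Lucas-1-0-½ A ¬𝒮 (suc k) = (λ iA^ → ⊥-elim (¬𝒮 k iA^)) , (λ iU½ → ⊥-elim (¬lucas-1-0-½-suc k iU½))

𝒮-isLucas : ∀ A → IsLucasSemigroup (𝒮 A)
𝒮-isLucas A with ↧ₙ (det A) ℕ.≟ 1 | ↧ₙ (trace A) ℕ.≟ 1
... | no ↧det≢1 | _ = + 1 , 0ℤ , 1/ₙ 2 , 𝒮≐Lucas-1-0-½ A λ k iA^ → ↧det≢1 (𝒮-suc⇒det-integral A k iA^)
... | yes ↧det≡1 | no ↧trace≢1 = + 1 , 0ℤ , 1/ₙ 2 , 𝒮≐Lucas-1-0-½ A λ k iA^ →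
  ↧trace≢1 (𝒮-suc⇒trace-integral A {↥ det A} k (↧ₙ≡1⇒≡↥/1 (det A) ↧det≡1) iA^)
... | yes ↧det≡1 | yes ↧trace≡1 = ↥ trace A , ↥ det A , R ,
  𝒮≐Lucas (↧ₙ≡1⇒≡↥/1 (trace A) ↧trace≡1) (↧ₙ≡1⇒≡↥/1 (det A) ↧det≡1) {R} lcd
  where
  R : ℚ
  R = 1/ₙ (denominatorLcm A) {{denominatorLcm-nonZero A}}
  lcd : LeastCommonDenominator A (↧ₙ R)
  lcd = subst (LeastCommonDenominator A) (sym (↧ₙ-1/ₙ (denominatorLcm A) {{denominatorLcm-nonZero A}}))
              (denominatorLcm-least A)

-- Conjugate to the companion matrix of x² − P x + Q, with 1/b as its only non-integral entry.
companion : ℤ → ℤ → (b : ℕ) → .{{NonZero b}} → Mat2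
companion P Q b zero       zero       = P / 1
companion P Q b zero       (suc zero) = ℚ.- ((Q / 1) ℚ.* (+ b / 1))
companion P Q b (suc zero) zero       = 1/ₙ b
companion P Q b (suc zero) (suc zero) = 0ℚ

module _ (P Q : ℤ) (b : ℕ) .{{_ : NonZero b}} where

  private
    C : Mat2
    C = companion P Q b

  trace-companion : trace C ≡ P / 1
  trace-companion = ℚ.+-identityʳ (P / 1)

  det-companion : det C ≡ Q / 1
  det-companion = begin
    (P / 1) ℚ.* 0ℚ ℚ.- ℚ.- ((Q / 1) ℚ.* (+ b / 1)) ℚ.* h
      ≡⟨ regroup (P / 1) (Q / 1) (+ b / 1) h ⟩
    (Q / 1) ℚ.* (h ℚ.* (+ b / 1))
      ≡⟨ cong (λ d → (Q / 1) ℚ.* (h ℚ.* (+ d / 1))) (↧ₙ-1/ₙ b) ⟨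
    (Q / 1) ℚ.* (h ℚ.* (↧ h / 1))
      ≡⟨ cong ((Q / 1) ℚ.*_) (trans (p*↧p≡↥p h) (cong (_/ 1) (↥-1/ₙ b))) ⟩
    (Q / 1) ℚ.* 1ℚ
      ≡⟨ ℚ.*-identityʳ (Q / 1) ⟩
    Q / 1
      ∎
    where
    open ≡-Reasoning
    h : ℚ
    h = 1/ₙ b
    regroup : ∀ p q b h → p ℚ.* 0ℚ ℚ.- ℚ.- (q ℚ.* b) ℚ.* h ≡ q ℚ.* (h ℚ.* b)
    regroup = solve-∀ ℚ-ring

  companion-least : LeastCommonDenominator C b
  companion-least = record
    { common = λ where
        zero       zero       → isInteger⇒↧∣ b (isInteger-/1 P)
        zero       (suc zero) → isInteger⇒↧∣ b (isInteger-neg (isInteger-* (isInteger-/1 Q) (isInteger-/1 (+ b))))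
        (suc zero) zero       → ∣-reflexive (↧ₙ-1/ₙ b)
        (suc zero) (suc zero) → 1∣ b
    ; least = λ ↧∣m → subst (_∣ _) (↧ₙ-1/ₙ b) (↧∣m (suc zero) zero)
    }

≐-sym : ∀ {S T} → S ≐ T → T ≐ S
≐-sym S≐T n = swap (S≐T n)

≐-trans : ∀ {S T V} → S ≐ T → T ≐ V → S ≐ V
≐-trans S≐T T≐V n = (λ s → proj₁ (T≐V n) (proj₁ (S≐T n) s)) , (λ v → proj₂ (S≐T n) (proj₂ (T≐V n) v))

lucas-dim2Realizable : ∀ P Q R → Dim2Realizable (Lucas P Q R)
lucas-dim2Realizable P Q R = companion P Q (↧ₙ R) ,
  ≐-sym (𝒮≐Lucas (trace-companion P Q (↧ₙ R)) (det-companion P Q (↧ₙ R)) (companion-least P Q (↧ₙ R)))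

isLucasSemigroup-resp-≐ : ∀ {S T} → S ≐ T → IsLucasSemigroup T → IsLucasSemigroup S
isLucasSemigroup-resp-≐ S≐T (P , Q , R , T≐L) = P , Q , R , ≐-trans S≐T T≐L

dim2Realizable-resp-≐ : ∀ {S T} → S ≐ T → Dim2Realizable T → Dim2Realizable S
dim2Realizable-resp-≐ S≐T (A , T≐𝒮A) = A , ≐-trans S≐T T≐𝒮A

theorem6p2 : (S : Subset) → IsNumericalSemigroup S →
    (Dim2Realizable S → IsLucasSemigroup S) × (IsLucasSemigroup S → Dim2Realizable S)
theorem6p2 S _ =
  (λ (A , S≐𝒮A) → isLucasSemigroup-resp-≐ S≐𝒮A (𝒮-isLucas A)) ,
  (λ (P , Q , R , S≐L) → dim2Realizable-resp-≐ S≐L (lucas-dim2Realizable P Q R))
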